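{- Let $w\in S_n$. Every greedy chain $C$ in the Bruhat interval $[\mathrm{id},w]$ has weight $m_C=\mathrm{GW}(w)$, where \[\mathrm{GW}(w)=\prod_{(a,b)\in\mathrm{Inv}(w)}(x_a+x_{a+1}+\dots+x_{b-1}).\]
   Context: $S_n$ is the symmetric group on $[n]$; $\mathrm{Inv}(w)$ is the set of pairs $(a,b)$, $a<b$, with $w(a)>w(b)$, and $\ell(w)=|\mathrm{Inv}(w)|$. For $a<b$, $wt_{ab}$ swaps entries in positions $a,b$. Bruhat covers: $u\lessdot v$ iff $v=ut_{ab}$ ($a<b$) and $\ell(v)=\ell(u)+1$; $[u,w]=\{v: u\le v\le w\}$. Edge weight $m(u\lessdot ut_{ab})=x_a+\dots+x_{b-1}$; the weight of a saturated chain $C=(u_0\lessdot\cdots\lessdot u_\ell)$ is $m_C=\prod_i m(u_{i-1}\lessdot u_i)$. A saturated chain $u=w_0\lessdot\cdots\lessdot w_\ell=w$ is greedy if for every $i$, writing $w_i=w_{i-1}t_{ab}$ with $a<b$, there is no $w'_{i-1}\in[u,w]$ with $w'_{i-1}\lessdot w_i$ and either $w_i=w'_{i-1}t_{ab'}$ with $b'>b$ or $w_i=w'_{i-1}t_{a'b}$ with $a'<a$. -}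

module Defs where

open import Data.Nat using (ℕ; suc)
open import Data.Fin using (Fin) renaming (_<_ to _<ᶠ_; _≤_ to _≤ᶠ_)
open import Data.Fin.Properties using () renaming (_<?_ to _<ᶠ?_; _≤?_ to _≤ᶠ?_)
open import Data.Integer using (ℤ; _+_; _*_; 0ℤ; 1ℤ)
open import Data.List using (List; []; _∷_; map; concatMap; filter; length; foldr; allFin)
open import Data.Vec using (Vec; lookup; _[_]≔_)
import Data.Vec as V
open import Data.Product using (Σ; _×_; _,_; proj₁; proj₂)
open import Data.Sum using (_⊎_)
open import Relation.Nullary using (¬_; Dec)
open import Relation.Nullary.Decidable using (_×-dec_)
open import Relation.Binary.PropositionalEquality using (_≡_)

-- Permutations of [n] in one-line notation, positions/values 0-based:
-- w(i) = lookup w i.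
Perm : ℕ → Set
Perm n = Vec (Fin n) n

IsPerm : ∀ {n} → Perm n → Set
IsPerm {n} w = ∀ (i j : Fin n) → lookup w i ≡ lookup w j → i ≡ j

idPerm : ∀ {n} → Perm n
idPerm {n} = V.allFin n

swap : ∀ {n} → Perm n → Fin n → Fin n → Perm n
swap w a b = (w [ a ]≔ lookup w b) [ b ]≔ lookup w a

pairs : ∀ n → List (Fin n × Fin n)
pairs n = concatMap (λ a → map (λ b → (a , b)) (allFin n)) (allFin n)

IsInv : ∀ {n} → Perm n → Fin n × Fin n → Set
IsInv w (a , b) = (a <ᶠ b) × (lookup w b <ᶠ lookup w a)

isInv? : ∀ {n} (w : Perm n) (p : Fin n × Fin n) → Dec (IsInv w p)
isInv? w (a , b) = (a <ᶠ? b) ×-dec (lookup w b <ᶠ? lookup w a)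

Inv : ∀ {n} → Perm n → List (Fin n × Fin n)
Inv {n} w = filter (isInv? w) (pairs n)

len : ∀ {n} → Perm n → ℕ
len w = length (Inv w)

record Cover {n} (u v : Perm n) (a b : Fin n) : Set where
  field
    a<b   : a <ᶠ b
    v≡ut  : v ≡ swap u a b
    lenUp : len v ≡ suc (len u)

data Chain {n} (u : Perm n) : Perm n → Set where
  [] : Chain u u
  _▷_ : ∀ {v v'} {a b : Fin n} → Chain u v → Cover v v' a b → Chain u v'

_≤B_ : ∀ {n} → Perm n → Perm n → Set
u ≤B v = Chain u v

InInterval : ∀ {n} → Perm n → Perm n → Perm n → Set
InInterval u w v = (u ≤B v) × (v ≤B w)

GreedyStep : ∀ {n} → Perm n → Perm n → Perm n → Fin n → Fin n → Set
GreedyStep {n} u w v' a b =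
  ¬ (Σ (Perm n) λ w' → InInterval u w w' ×
       ((Σ (Fin n) λ b' → (b <ᶠ b') × Cover w' v' a b')
        ⊎ (Σ (Fin n) λ a' → (a' <ᶠ a) × Cover w' v' a' b)))

AllGreedy : ∀ {n} (u w : Perm n) {v : Perm n} → Chain u v → Set
AllGreedy u w [] = Data.Unit.⊤ where import Data.Unit
AllGreedy u w (_▷_ {v' = v'} {a} {b} C _) = AllGreedy u w C × GreedyStep u w v' a b

Greedy : ∀ {n} {u w : Perm n} → Chain u w → Set
Greedy {u = u} {w} C = AllGreedy u w C

edgeWt : ∀ {n} → (Fin n → ℤ) → Fin n → Fin n → ℤ
edgeWt {n} x a b =
  foldr _+_ 0ℤ (map x (filter (λ i → (a ≤ᶠ? i) ×-dec (i <ᶠ? b)) (allFin n)))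

chainWt : ∀ {n} {u v : Perm n} → (Fin n → ℤ) → Chain u v → ℤ
chainWt x [] = 1ℤ
chainWt x (_▷_ {a = a} {b} C _) = chainWt x C * edgeWt x a b

GW : ∀ {n} → Perm n → (Fin n → ℤ) → ℤ
GW w x = foldr _*_ 1ℤ (map (λ p → edgeWt x (proj₁ p) (proj₂ p)) (Inv w))

-- Along a greedy chain every step v t_ab ⋖ v exchanges two consecutive values, v(a) = v(b) + 1.
-- Otherwise some position q carries a value strictly between v(b) and v(a); as the step is a
-- cover, q lies left of a or right of b, and the extremal such position yields a lower cover
-- v t_cb ⋖ v with c < a, or v t_ac ⋖ v with c > b, inside [id, w], which greediness forbids.
-- Exchanging consecutive values changes the inversion set by the single pair (a, b), so each
-- step multiplies GW by its edge weight, and GW(id) = 1.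
-- Covers are recognised through ℓ(x) = ℓ(x t_ac) + 1 + 2k, where k counts the positions strictly
-- between a and c whose values lie strictly between x(c) and x(a); this is proved by induction on
-- x(a) − x(c), splitting x t_ac into exchanges of consecutive values.

module Submission where

open import Defs
open import Data.Nat using (ℕ)
open import Data.Fin using (Fin)
open import Data.Integer using (ℤ)
open import Relation.Binary.PropositionalEquality using (_≡_)

open import Data.Empty using (⊥-elim)
open import Data.Fin as F using (toℕ; fromℕ<; punchOut; inject₁) renaming (_<_ to _<ᶠ_)
open import Data.Fin.Properties
  using (_≟_; toℕ-injective; toℕ<n; toℕ-fromℕ<; toℕ-inject₁; punchOut-injective; injective⇒≤; any?)
import Data.Fin.Permutation.Components as Transposition
open import Data.Integer using (_*_; 1ℤ)
open import Data.Integer.Properties using (*-comm; *-assoc)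
open import Data.List using (List; []; _∷_; _++_; filter; length; map; foldr; allFin; concatMap; cartesianProduct)
open import Data.List.Membership.Propositional using (_∈_; lose)
open import Data.List.Membership.Propositional.Properties using (∈-allFin; ∈-filter⁺; ∈-cartesianProduct⁺)
open import Data.List.Properties using (filter-accept; filter-reject; filter-≐; filter-some; filter-none)
open import Data.List.Relation.Unary.All as All using (All; []; _∷_)
open import Data.List.Relation.Unary.All.Properties using (all-filter)
open import Data.List.Relation.Unary.Any using (here; there)
open import Data.List.Relation.Unary.Unique.Propositional using (Unique; _∷_)
open import Data.List.Relation.Unary.Unique.Propositional.Properties using (allFin⁺; cartesianProduct⁺)
import Data.List.Extrema
open import Data.Nat as ℕ using (zero; suc; _+_; _≤_; _<_; z≤n; s≤s; s<s; s<s⁻¹)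
open import Data.Nat.Properties as ℕ
  using (<-irrefl; <-asym; <-trans; ≤-trans; ≤-refl; <-cmp; ≤∧≢⇒<; ≤-totalOrder; suc-injective)
open import Data.Nat.Tactic.RingSolver using (solve-∀)
open import Data.Product using (∃; ∃₂; _×_; _,_; proj₁; proj₂)
open import Data.Sum using (_⊎_; inj₁; inj₂)
open import Data.Vec using (lookup; _[_]≔_)
open import Data.Vec.Properties using (lookup∘update; lookup∘update′; tabulate∘lookup; tabulate-cong; lookup-allFin)
open import Function using (_∘_; _⇔_; mk⇔; Equivalence)
open import Function.Properties.Equivalence using () renaming (refl to ⇔-refl; sym to ⇔-sym)
open import Level using (0ℓ)
open import Relation.Binary.Definitions using (tri<; tri≈; tri>)
open import Relation.Binary.PropositionalEquality
  using (_≢_; refl; sym; trans; cong; cong₂; subst; subst₂; module ≡-Reasoning)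
open import Relation.Nullary using (¬_; yes; no)
open import Relation.Nullary.Decidable using (_×-dec_)
open import Relation.Unary using (Pred; Decidable)

open Equivalence using (to; from)

module _ {A : Set} {P Q : Pred A 0ℓ} (P? : Decidable P) (Q? : Decidable Q) where

  filter-cong : ∀ {L} → All (λ r → P r ⇔ Q r) L → filter P? L ≡ filter Q? L
  filter-cong [] = refl
  filter-cong {r ∷ L} (P⇔Q ∷ agree) with P? r
  ... | yes pr = trans (cong (r ∷_) (filter-cong agree)) (sym (filter-accept Q? (to P⇔Q pr)))
  ... | no ¬pr = trans (filter-cong agree) (sym (filter-reject Q? (¬pr ∘ from P⇔Q)))

  filter-split : ∀ {q L} → Unique L → q ∈ L → (∀ {r} → r ≢ q → P r ⇔ Q r) → P q → ¬ Q q →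
                 ∃₂ λ xs ys → filter P? L ≡ xs ++ q ∷ ys × filter Q? L ≡ xs ++ ys
  filter-split {L = q ∷ L} (q∉L ∷ _) (here refl) agree pq ¬qq =
    [] , filter Q? L ,
    trans (filter-accept P? pq) (cong (q ∷_) (filter-cong (All.map (λ q≢r → agree (q≢r ∘ sym)) q∉L))) ,
    filter-reject Q? ¬qq
  filter-split {L = r ∷ L} (r∉L ∷ unique) (there q∈L) agree pq ¬qq
    with filter-split unique q∈L agree pq ¬qq | P? r
  ... | xs , ys , eqP , eqQ | yes pr =
    r ∷ xs , ys , cong (r ∷_) eqP , trans (filter-accept Q? (to (agree (All.lookup r∉L q∈L)) pr)) (cong (r ∷_) eqQ)
  ... | xs , ys , eqP , eqQ | no ¬pr =
    xs , ys , eqP , trans (filter-reject Q? (¬pr ∘ from (agree (All.lookup r∉L q∈L)))) eqQ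

  filter-≐-except : ∀ {q L} → (∀ {r} → r ≢ q → P r ⇔ Q r) → ¬ P q → ¬ Q q → filter P? L ≡ filter Q? L
  filter-≐-except {q} {L} agree ¬pq ¬qq = filter-≐ P? Q? (P⊆Q , Q⊆P) L
    where
    P⊆Q : ∀ {r} → P r → Q r
    P⊆Q pr = to (agree λ { refl → ¬pq pr }) pr
    Q⊆P : ∀ {r} → Q r → P r
    Q⊆P qr = from (agree λ { refl → ¬qq qr }) qr

length-insert : ∀ {A : Set} (xs : List A) {q ys} → length (xs ++ q ∷ ys) ≡ suc (length (xs ++ ys))
length-insert []       = refl
length-insert (_ ∷ xs) = cong suc (length-insert xs)

product-insert : ∀ {A : Set} (h : A → ℤ) (xs : List A) {q ys} →
                 foldr _*_ 1ℤ (map h (xs ++ q ∷ ys)) ≡ foldr _*_ 1ℤ (map h (xs ++ ys)) * h q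
product-insert h []       {q} = *-comm (h q) _
product-insert h (x ∷ xs) {q} = trans (cong (h x *_) (product-insert h xs)) (sym (*-assoc (h x) _ (h q)))

module _ {A : Set} {P : Pred A 0ℓ} (P? : Decidable P) where

  length-filter≡0⇒∁ : ∀ {L r} → length (filter P? L) ≡ 0 → r ∈ L → ¬ P r
  length-filter≡0⇒∁ len≡0 r∈L pr = ℕ.<⇒≢ (filter-some P? (lose r∈L pr)) (sym len≡0)

module _ {n} {P : Pred (Fin n) 0ℓ} (P? : Decidable P) (f : Fin n → ℕ) where

  open Data.List.Extrema ≤-totalOrder

  private
    candidates : List (Fin n)
    candidates = filter P? (allFin n)

  argmax-Fin : ∀ {i} → P i → ∃ λ j → P j × (∀ {k} → P k → f k ≤ f j)
  argmax-Fin {i} pi =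
    argmax f i candidates , argmax-all f pi (all-filter P? (allFin n)) ,
    λ {k} pk → All.lookup (f[xs]≤f[argmax] i candidates) (∈-filter⁺ P? (∈-allFin k) pk)

  argmin-Fin : ∀ {i} → P i → ∃ λ j → P j × (∀ {k} → P k → f j ≤ f k)
  argmin-Fin {i} pi =
    argmin f i candidates , argmin-all f pi (all-filter P? (allFin n)) ,
    λ {k} pk → All.lookup (f[argmin]≤f[xs] i candidates) (∈-filter⁺ P? (∈-allFin k) pk)

infix 10 _⟨_⟩

_⟨_⟩ : ∀ {n} → Perm n → Fin n → ℕ
x ⟨ i ⟩ = toℕ (lookup x i)

perm-ext : ∀ {n} {x y : Perm n} → (∀ i → lookup x i ≡ lookup y i) → x ≡ y
perm-ext {x = x} {y} x≗y = trans (sym (tabulate∘lookup x)) (trans (tabulate-cong x≗y) (tabulate∘lookup y))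

injective-values : ∀ {n} (x : Perm n) → IsPerm x → ∀ {i j} → x ⟨ i ⟩ ≡ x ⟨ j ⟩ → i ≡ j
injective-values x perm eq = perm _ _ (toℕ-injective eq)

module _ {n} (x : Perm n) (a b : Fin n) where

  lookup-swapˡ : lookup (swap x a b) a ≡ lookup x b
  lookup-swapˡ with a ≟ b
  ... | yes refl = lookup∘update a (x [ a ]≔ lookup x a) (lookup x a)
  ... | no a≢b  = trans (lookup∘update′ a≢b (x [ a ]≔ lookup x b) (lookup x a)) (lookup∘update a x (lookup x b))

  lookup-swapʳ : lookup (swap x a b) b ≡ lookup x a
  lookup-swapʳ = lookup∘update b (x [ a ]≔ lookup x b) (lookup x a)

  lookup-swap-other : ∀ {i} → i ≢ a → i ≢ b → lookup (swap x a b) i ≡ lookup x i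
  lookup-swap-other i≢a i≢b =
    trans (lookup∘update′ i≢b (x [ a ]≔ lookup x b) (lookup x a)) (lookup∘update′ i≢a x (lookup x b))

  lookup-swap : ∀ i → lookup (swap x a b) i ≡ lookup x (Transposition.transpose a b i)
  lookup-swap i with i ≟ a
  ... | yes refl = lookup-swapˡ
  ... | no i≢a with i ≟ b
  ...   | yes refl = lookup-swapʳ
  ...   | no i≢b   = lookup-swap-other i≢a i≢b

swap-involutive : ∀ {n} (x : Perm n) (a b : Fin n) → swap (swap x a b) a b ≡ x
swap-involutive x a b = perm-ext twice
  where
  twice : ∀ i → lookup (swap (swap x a b) a b) i ≡ lookup x i
  twice i with i ≟ a | i ≟ b
  ... | _        | yes refl = trans (lookup-swapʳ (swap x a i) a i) (lookup-swapˡ x a i)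
  ... | yes refl | no _     = trans (lookup-swapˡ (swap x i b) i b) (lookup-swapʳ x i b)
  ... | no i≢a   | no i≢b   = trans (lookup-swap-other (swap x a b) a b i≢a i≢b) (lookup-swap-other x a b i≢a i≢b)

swap-comm : ∀ {n} (x : Perm n) (a b : Fin n) → swap x a b ≡ swap x b a
swap-comm x a b = perm-ext exchange
  where
  exchange : ∀ i → lookup (swap x a b) i ≡ lookup (swap x b a) i
  exchange i with i ≟ a | i ≟ b
  ... | yes refl | _        = trans (lookup-swapˡ x i b) (sym (lookup-swapʳ x b i))
  ... | no _     | yes refl = trans (lookup-swapʳ x a i) (sym (lookup-swapˡ x i a))
  ... | no i≢a   | no i≢b   = trans (lookup-swap-other x a b i≢a i≢b) (sym (lookup-swap-other x b a i≢b i≢a))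

swap-isPerm : ∀ {n} (x : Perm n) (a b : Fin n) → IsPerm x → IsPerm (swap x a b)
swap-isPerm {n} x a b perm i j eq = begin
  i                     ≡⟨ sym (Transposition.transpose-inverse b a) ⟩
  transpose b a (τ i)   ≡⟨ cong (transpose b a) (perm (τ i) (τ j) x[τi]≡x[τj]) ⟩
  transpose b a (τ j)   ≡⟨ Transposition.transpose-inverse b a ⟩
  j                     ∎
  where
  open ≡-Reasoning
  open Transposition using (transpose)
  τ : Fin n → Fin n
  τ = transpose a b
  x[τi]≡x[τj] : lookup x (τ i) ≡ lookup x (τ j)
  x[τi]≡x[τj] = trans (sym (lookup-swap x a b i)) (trans eq (lookup-swap x a b j))

idPerm-isPerm : ∀ {n} → IsPerm (idPerm {n})
idPerm-isPerm i j eq = trans (sym (lookup-allFin i)) (trans eq (lookup-allFin j))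

values-surjective : ∀ {n} (x : Perm n) → IsPerm x → ∀ {k} → k < n → ∃ λ i → x ⟨ i ⟩ ≡ k
values-surjective {suc m} x perm {k} k<n with any? (λ i → lookup x i ≟ fromℕ< k<n)
... | yes (i , xi≡k) = i , trans (cong toℕ xi≡k) (toℕ-fromℕ< k<n)
... | no ∄i          = ⊥-elim (<-irrefl refl (injective⇒≤ punchOut-k-injective))
  where
  -- without k among its values, x would inject Fin (suc m) into Fin m
  k≢x : ∀ i → fromℕ< k<n ≢ lookup x i
  k≢x i eq = ∄i (i , sym eq)
  punchOut-k-injective : ∀ {i j} → punchOut (k≢x i) ≡ punchOut (k≢x j) → i ≡ j
  punchOut-k-injective eq = perm _ _ (punchOut-injective (k≢x _) (k≢x _) eq)

cover-lower : ∀ {n} {u v : Perm n} {a b} → Cover u v a b → u ≡ swap v a b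
cover-lower {u = u} {a = a} {b} cov = trans (sym (swap-involutive u a b)) (cong (λ t → swap t a b) (sym (Cover.v≡ut cov)))

cover-isPerm : ∀ {n} {u v : Perm n} {a b} → IsPerm v → Cover u v a b → IsPerm u
cover-isPerm {v = v} {a} {b} perm cov = subst IsPerm (sym (cover-lower cov)) (swap-isPerm v a b perm)

chain-isPerm : ∀ {n} {v : Perm n} → Chain idPerm v → IsPerm v
chain-isPerm []                             = idPerm-isPerm
chain-isPerm (_▷_ {v = u} {a = a} {b} chain cov) rewrite Cover.v≡ut cov = swap-isPerm u a b (chain-isPerm chain)

infixr 5 _++ᶜ_

_++ᶜ_ : ∀ {n} {u v w : Perm n} → Chain u v → Chain v w → Chain u w
C ++ᶜ []      = C
C ++ᶜ (D ▷ c) = (C ++ᶜ D) ▷ c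

pairs≡cartesianProduct : ∀ n → pairs n ≡ cartesianProduct (allFin n) (allFin n)
pairs≡cartesianProduct n = go (allFin n)
  where
  go : ∀ (as : List (Fin n)) → concatMap (λ a → map (a ,_) (allFin n)) as ≡ cartesianProduct as (allFin n)
  go []       = refl
  go (a ∷ as) = cong (map (a ,_) (allFin n) ++_) (go as)

pairs-unique : ∀ n → Unique (pairs n)
pairs-unique n rewrite pairs≡cartesianProduct n = cartesianProduct⁺ (allFin⁺ n) (allFin⁺ n)

∈-pairs : ∀ {n} (a b : Fin n) → (a , b) ∈ pairs n
∈-pairs {n} a b rewrite pairs≡cartesianProduct n = ∈-cartesianProduct⁺ (∈-allFin a) (∈-allFin b)

<suc⇔< : ∀ {t γ} → t ≢ γ → t < suc γ ⇔ t < γ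
<suc⇔< t≢γ = mk⇔ (λ t<sγ → ≤∧≢⇒< (ℕ.m<1+n⇒m≤n t<sγ) t≢γ) ℕ.m<n⇒m<1+n

<⇔suc< : ∀ {s γ} → s ≢ suc γ → γ < s ⇔ suc γ < s
<⇔suc< s≢sγ = mk⇔ (λ γ<s → ≤∧≢⇒< γ<s (s≢sγ ∘ sym)) (<-trans (ℕ.n<1+n _))

data Exchanged (γ : ℕ) : ℕ → ℕ → Set where
  lower : Exchanged γ γ (suc γ)
  upper : Exchanged γ (suc γ) γ
  fixed : ∀ {s} → s ≢ γ → s ≢ suc γ → Exchanged γ s s

exchanged-<⇔ : ∀ {γ s s′ t t′} → Exchanged γ s s′ → Exchanged γ t t′ →
               ¬ (t ≡ γ × s ≡ suc γ) → ¬ (t ≡ suc γ × s ≡ γ) → t < s ⇔ t′ < s′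
exchanged-<⇔ lower lower _ _ = mk⇔ s<s s<s⁻¹
exchanged-<⇔ lower upper _ ¬tsγ = ⊥-elim (¬tsγ (refl , refl))
exchanged-<⇔ lower (fixed t≢γ _) _ _ = ⇔-sym (<suc⇔< t≢γ)
exchanged-<⇔ upper lower ¬tγs _ = ⊥-elim (¬tγs (refl , refl))
exchanged-<⇔ upper upper _ _ = mk⇔ s<s⁻¹ s<s
exchanged-<⇔ upper (fixed t≢γ _) _ _ = <suc⇔< t≢γ
exchanged-<⇔ (fixed _ s≢sγ) lower _ _ = <⇔suc< s≢sγ
exchanged-<⇔ (fixed _ s≢sγ) upper _ _ = ⇔-sym (<⇔suc< s≢sγ)
exchanged-<⇔ (fixed _ _) (fixed _ _) _ _ = ⇔-refl

module _ {n} (x : Perm n) (perm : IsPerm x) {p q : Fin n} (p<q : p <ᶠ q) (adjacent : x ⟨ p ⟩ ≡ suc (x ⟨ q ⟩)) where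

  swap-adjacent-exchanged : ∀ k → Exchanged (x ⟨ q ⟩) (x ⟨ k ⟩) (swap x p q ⟨ k ⟩)
  swap-adjacent-exchanged k with k ≟ p | k ≟ q
  ... | yes refl | _ =
    subst₂ (Exchanged (x ⟨ q ⟩)) (sym adjacent) (sym (cong toℕ (lookup-swapˡ x p q))) upper
  ... | no _ | yes refl =
    subst (Exchanged (x ⟨ q ⟩) (x ⟨ q ⟩)) (sym (trans (cong toℕ (lookup-swapʳ x p q)) adjacent)) lower
  ... | no k≢p | no k≢q =
    subst (Exchanged (x ⟨ q ⟩) (x ⟨ k ⟩)) (sym (cong toℕ (lookup-swap-other x p q k≢p k≢q)))
      (fixed (k≢q ∘ injective-values x perm) (λ eq → k≢p (injective-values x perm (trans eq (sym adjacent)))))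

  inversions-agree : ∀ {r} → r ≢ (p , q) → IsInv x r ⇔ IsInv (swap x p q) r
  inversions-agree {i , j} r≢pq =
    mk⇔ (λ (i<j , inv) → i<j , to (order i<j) inv) (λ (i<j , inv) → i<j , from (order i<j) inv)
    where
    order : i <ᶠ j → x ⟨ j ⟩ < x ⟨ i ⟩ ⇔ swap x p q ⟨ j ⟩ < swap x p q ⟨ i ⟩
    order i<j = exchanged-<⇔ (swap-adjacent-exchanged i) (swap-adjacent-exchanged j)
      (λ (j↦q , i↦p) → r≢pq (cong₂ _,_ (injective-values x perm (trans i↦p (sym adjacent)))
                                          (injective-values x perm j↦q)))
      (λ (j↦p , i↦q) → <-asym p<q (subst₂ _<ᶠ_ (injective-values x perm i↦q)
                                              (injective-values x perm (trans j↦p (sym adjacent))) i<j))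

  Inv-swap-adjacent : ∃₂ λ xs ys → Inv x ≡ xs ++ (p , q) ∷ ys × Inv (swap x p q) ≡ xs ++ ys
  Inv-swap-adjacent =
    filter-split (isInv? x) (isInv? (swap x p q)) (pairs-unique n) (∈-pairs p q) inversions-agree
      (p<q , subst (x ⟨ q ⟩ <_) (sym adjacent) ≤-refl)
      (λ (_ , inv) → <-asym (subst₂ _<_ (cong toℕ (lookup-swapʳ x p q)) (cong toℕ (lookup-swapˡ x p q)) inv)
                            (subst (x ⟨ q ⟩ <_) (sym adjacent) ≤-refl))

  len-swap-adjacent : len x ≡ suc (len (swap x p q))
  len-swap-adjacent with xs , ys , Inv-x , Inv-y ← Inv-swap-adjacent =
    trans (cong length Inv-x) (trans (length-insert xs) (cong (suc ∘ length) (sym Inv-y)))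

len-swap-adjacent⁻ : ∀ {n} (x : Perm n) → IsPerm x → ∀ {p q} → q <ᶠ p → x ⟨ p ⟩ ≡ suc (x ⟨ q ⟩) →
                     len (swap x p q) ≡ suc (len x)
len-swap-adjacent⁻ x perm {p} {q} q<p adjacent =
  trans (len-swap-adjacent (swap x p q) (swap-isPerm x p q perm) q<p adjacent′)
        (cong (suc ∘ len) (trans (swap-comm (swap x p q) q p) (swap-involutive x p q)))
  where
  adjacent′ : swap x p q ⟨ q ⟩ ≡ suc (swap x p q ⟨ p ⟩)
  adjacent′ = trans (cong toℕ (lookup-swapʳ x p q)) (trans adjacent (cong (suc ∘ toℕ) (sym (lookup-swapˡ x p q))))

swap-swap-shift : ∀ {n} (x : Perm n) {a c d : Fin n} → a ≢ c → a ≢ d → c ≢ d →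
                  swap (swap x a d) a c ≡ swap (swap x a c) c d
swap-swap-shift x {a} {c} {d} a≢c a≢d c≢d = perm-ext shift
  where
  shift : ∀ i → lookup (swap (swap x a d) a c) i ≡ lookup (swap (swap x a c) c d) i
  shift i with i ≟ a | i ≟ c | i ≟ d
  ... | yes refl | _ | _ =
    trans (trans (lookup-swapˡ (swap x i d) i c) (lookup-swap-other x i d (a≢c ∘ sym) c≢d))
          (sym (trans (lookup-swap-other (swap x i c) c d a≢c a≢d) (lookup-swapˡ x i c)))
  ... | no _ | yes refl | _ =
    trans (trans (lookup-swapʳ (swap x a d) a i) (lookup-swapˡ x a d))
          (sym (trans (lookup-swapˡ (swap x a i) i d) (lookup-swap-other x a i (a≢d ∘ sym) (c≢d ∘ sym))))
  ... | no i≢a | no i≢c | yes refl =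
    trans (trans (lookup-swap-other (swap x a i) a c i≢a i≢c) (lookup-swapʳ x a i))
          (sym (trans (lookup-swapʳ (swap x a c) c i) (lookup-swapʳ x a c)))
  ... | no i≢a | no i≢c | no i≢d =
    trans (trans (lookup-swap-other (swap x a d) a c i≢a i≢c) (lookup-swap-other x a d i≢a i≢d))
          (sym (trans (lookup-swap-other (swap x a c) c d i≢c i≢d) (lookup-swap-other x a c i≢a i≢c)))

Inner : ∀ {n} → Perm n → Fin n → Fin n → Fin n → Set
Inner x a c d = a <ᶠ d × d <ᶠ c × x ⟨ c ⟩ < x ⟨ d ⟩ × x ⟨ d ⟩ < x ⟨ a ⟩

inner? : ∀ {n} (x : Perm n) (a c : Fin n) → Decidable (Inner x a c)
inner? x a c d =
  (a F.<? d) ×-dec ((d F.<? c) ×-dec ((x ⟨ c ⟩ ℕ.<? x ⟨ d ⟩) ×-dec (x ⟨ d ⟩ ℕ.<? x ⟨ a ⟩)))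

innerCount : ∀ {n} → Perm n → Fin n → Fin n → ℕ
innerCount {n} x a c = length (filter (inner? x a c) (allFin n))

innerCount≡0⇒¬Inner : ∀ {n} {x : Perm n} {a c} → innerCount x a c ≡ 0 → ∀ d → ¬ Inner x a c d
innerCount≡0⇒¬Inner {n} {x} {a} {c} count≡0 d =
  length-filter≡0⇒∁ (inner? x a c) {L = allFin n} count≡0 (∈-allFin d)

¬Inner⇒innerCount≡0 : ∀ {n} {x : Perm n} {a c} → (∀ d → ¬ Inner x a c d) → innerCount x a c ≡ 0
¬Inner⇒innerCount≡0 {n} {x} {a} {c} ¬inner = cong length (filter-none (inner? x a c) (All.universal ¬inner (allFin n)))

module _ {n} (x : Perm n) (perm : IsPerm x) {a c d : Fin n} (a<c : a <ᶠ c)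
         (adjacent : x ⟨ a ⟩ ≡ suc (x ⟨ d ⟩)) (xc<xd : x ⟨ c ⟩ < x ⟨ d ⟩) where

  private
    x′ : Perm n
    x′ = swap x a d

    c≢d : c ≢ d
    c≢d refl = <-irrefl refl xc<xd

    x′-c : x′ ⟨ c ⟩ ≡ x ⟨ c ⟩
    x′-c = cong toℕ (lookup-swap-other x a d (λ { refl → <-irrefl refl a<c }) c≢d)

    x′-a : x′ ⟨ a ⟩ ≡ x ⟨ d ⟩
    x′-a = cong toℕ (lookup-swapˡ x a d)

    x′-d : x′ ⟨ d ⟩ ≡ x ⟨ a ⟩
    x′-d = cong toℕ (lookup-swapʳ x a d)

    inner-agree : ∀ {r} → r ≢ d → Inner x a c r ⇔ Inner x′ a c r
    inner-agree {r} r≢d = mk⇔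
      (λ (a<r , r<c , xc<xr , xr<xa) → a<r , r<c , subst₂ _<_ (sym x′-c) (sym (x′-r a<r)) xc<xr ,
         subst₂ _<_ (sym (x′-r a<r)) (sym x′-a) (to (<suc⇔< xr≢xd) (subst (x ⟨ r ⟩ <_) adjacent xr<xa)))
      (λ (a<r , r<c , xc<xr , xr<xa) → a<r , r<c , subst₂ _<_ x′-c (x′-r a<r) xc<xr ,
         subst (x ⟨ r ⟩ <_) (sym adjacent) (from (<suc⇔< xr≢xd) (subst₂ _<_ (x′-r a<r) x′-a xr<xa)))
      where
      xr≢xd : x ⟨ r ⟩ ≢ x ⟨ d ⟩
      xr≢xd = r≢d ∘ injective-values x perm
      x′-r : a <ᶠ r → x′ ⟨ r ⟩ ≡ x ⟨ r ⟩
      x′-r a<r = cong toℕ (lookup-swap-other x a d (λ { refl → <-irrefl refl a<r }) r≢d)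

    ¬inner-d : ¬ Inner x′ a c d
    ¬inner-d (_ , _ , _ , x′d<x′a) =
      <-asym (subst₂ _<_ x′-d x′-a x′d<x′a) (subst (x ⟨ d ⟩ <_) (sym adjacent) ≤-refl)

  innerCount-swap-inside : a <ᶠ d → d <ᶠ c → innerCount x a c ≡ suc (innerCount x′ a c)
  innerCount-swap-inside a<d d<c
    with xs , ys , inner-x , inner-x′ ← filter-split (inner? x a c) (inner? x′ a c) (allFin⁺ n) (∈-allFin d)
           inner-agree (a<d , d<c , xc<xd , subst (x ⟨ d ⟩ <_) (sym adjacent) ≤-refl) ¬inner-d =
    trans (cong length inner-x) (trans (length-insert xs) (cong (suc ∘ length) (sym inner-x′)))

  innerCount-swap-outside : ¬ (a <ᶠ d × d <ᶠ c) → innerCount x a c ≡ innerCount x′ a c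
  innerCount-swap-outside outside =
    cong length (filter-≐-except (inner? x a c) (inner? x′ a c) {L = allFin n} inner-agree
                   (λ (a<d , d<c , _) → outside (a<d , d<c)) ¬inner-d)

innerCount-adjacent : ∀ {n} {x : Perm n} {a c} → x ⟨ a ⟩ ≡ suc (x ⟨ c ⟩) → innerCount x a c ≡ 0
innerCount-adjacent {x = x} {a} {c} adjacent = ¬Inner⇒innerCount≡0 {x = x} λ d (_ , _ , xc<xd , xd<xa) →
  ℕ.<⇒≱ xc<xd (ℕ.m<1+n⇒m≤n (subst (x ⟨ d ⟩ <_) adjacent xd<xa))

-- With x(d) = x(a) − 1, both x ↦ x t_ad and x t_ac ↦ x t_ad t_ac = x t_ac t_cd exchange
-- consecutive values, so each changes the length by one, in a direction fixed by where d lies.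
module _ {n} (x : Perm n) (perm : IsPerm x) {a c d : Fin n} (a<c : a <ᶠ c)
         (adjacent : x ⟨ a ⟩ ≡ suc (x ⟨ d ⟩)) (xc<xd : x ⟨ c ⟩ < x ⟨ d ⟩) where

  private
    x′ y z : Perm n
    x′ = swap x a d
    y  = swap x a c
    z  = swap x′ a c

    k k′ : ℕ
    k  = innerCount x a c
    k′ = innerCount x′ a c

    a≢c : a ≢ c
    a≢c refl = <-irrefl refl a<c

    a≢d : a ≢ d
    a≢d refl = ℕ.1+n≢n (sym adjacent)

    c≢d : c ≢ d
    c≢d refl = <-irrefl refl xc<xd

    z≡swap-y : z ≡ swap y c d
    z≡swap-y = swap-swap-shift x a≢c a≢d c≢d

    y-adjacent : y ⟨ c ⟩ ≡ suc (y ⟨ d ⟩)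
    y-adjacent = trans (cong toℕ (lookup-swapʳ x a c))
                       (trans adjacent (cong (suc ∘ toℕ) (sym (lookup-swap-other x a c (a≢d ∘ sym) (c≢d ∘ sym)))))

    perm-y : IsPerm y
    perm-y = swap-isPerm x a c perm

    len-z-below : d <ᶠ c → len z ≡ suc (len y)
    len-z-below d<c = trans (cong len z≡swap-y) (len-swap-adjacent⁻ y perm-y d<c y-adjacent)

    len-z-above : c <ᶠ d → len y ≡ suc (len z)
    len-z-above c<d = trans (len-swap-adjacent y perm-y c<d y-adjacent) (cong (suc ∘ len) (sym z≡swap-y))

    shuffle : ∀ l k → suc (suc l + suc (2 ℕ.* k)) ≡ l + suc (2 ℕ.* suc k)
    shuffle = solve-∀

  len-swap-step : len x′ ≡ len z + suc (2 ℕ.* k′) → len x ≡ len y + suc (2 ℕ.* k)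
  len-swap-step len-x′ with <-cmp (toℕ d) (toℕ a)
  ... | tri≈ _ d≡a _ = ⊥-elim (a≢d (sym (toℕ-injective d≡a)))
  ... | tri< d<a _ _ = suc-injective (begin
    suc (len x)                  ≡⟨ len-swap-adjacent⁻ x perm d<a adjacent ⟨
    len x′                       ≡⟨ len-x′ ⟩
    len z + suc (2 ℕ.* k′)       ≡⟨ cong (_+ suc (2 ℕ.* k′)) (len-z-below (<-trans d<a a<c)) ⟩
    suc (len y + suc (2 ℕ.* k′)) ≡⟨ cong (λ i → suc (len y + suc (2 ℕ.* i))) count ⟨
    suc (len y + suc (2 ℕ.* k))  ∎)
    where
    open ≡-Reasoning
    count : k ≡ k′
    count = innerCount-swap-outside x perm a<c adjacent xc<xd (λ (a<d , _) → <-asym a<d d<a)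
  ... | tri> _ _ a<d with <-cmp (toℕ d) (toℕ c)
  ...   | tri≈ _ d≡c _ = ⊥-elim (c≢d (sym (toℕ-injective d≡c)))
  ...   | tri< d<c _ _ = begin
    len x                              ≡⟨ len-swap-adjacent x perm a<d adjacent ⟩
    suc (len x′)                       ≡⟨ cong suc len-x′ ⟩
    suc (len z + suc (2 ℕ.* k′))       ≡⟨ cong (λ l → suc (l + suc (2 ℕ.* k′))) (len-z-below d<c) ⟩
    suc (suc (len y) + suc (2 ℕ.* k′)) ≡⟨ shuffle (len y) k′ ⟩
    len y + suc (2 ℕ.* suc k′)         ≡⟨ cong (λ i → len y + suc (2 ℕ.* i)) count ⟨
    len y + suc (2 ℕ.* k)              ∎
    where
    open ≡-Reasoning
    count : k ≡ suc k′
    count = innerCount-swap-inside x perm a<c adjacent xc<xd a<d d<c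
  ...   | tri> _ _ c<d = begin
    len x                        ≡⟨ len-swap-adjacent x perm a<d adjacent ⟩
    suc (len x′)                 ≡⟨ cong suc len-x′ ⟩
    suc (len z) + suc (2 ℕ.* k′) ≡⟨ cong (_+ suc (2 ℕ.* k′)) (len-z-above c<d) ⟨
    len y + suc (2 ℕ.* k′)       ≡⟨ cong (λ i → len y + suc (2 ℕ.* i)) count ⟨
    len y + suc (2 ℕ.* k)        ∎
    where
    open ≡-Reasoning
    count : k ≡ k′
    count = innerCount-swap-outside x perm a<c adjacent xc<xd (λ (_ , d<c) → <-asym c<d d<c)

len-swap-gap : ∀ g {n} (x : Perm n) → IsPerm x → ∀ {a c} → a <ᶠ c → x ⟨ a ⟩ ≡ suc (g + x ⟨ c ⟩) →
               len x ≡ len (swap x a c) + suc (2 ℕ.* innerCount x a c)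
len-swap-gap zero x perm {a} {c} a<c adjacent =
  trans (len-swap-adjacent x perm a<c adjacent)
        (trans (ℕ.+-comm 1 _)
               (cong (λ k → len (swap x a c) + suc (2 ℕ.* k)) (sym (innerCount-adjacent {x = x} adjacent))))
len-swap-gap (suc g) x perm {a} {c} a<c gap
  with d , xd≡β ← values-surjective x perm
                     (<-trans (subst (suc (g + x ⟨ c ⟩) <_) (sym gap) ≤-refl) (toℕ<n (lookup x a))) =
  len-swap-step x perm a<c (trans gap (cong suc (sym xd≡β))) xc<xd
    (len-swap-gap g (swap x a d) (swap-isPerm x a d perm) a<c gap′)
  where
  xc<xd : x ⟨ c ⟩ < x ⟨ d ⟩
  xc<xd = subst (x ⟨ c ⟩ <_) (sym xd≡β) (s≤s (ℕ.m≤n+m _ g))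
  gap′ : swap x a d ⟨ a ⟩ ≡ suc (g + swap x a d ⟨ c ⟩)
  gap′ = trans (cong toℕ (lookup-swapˡ x a d))
               (trans xd≡β (cong (λ k → suc (g + toℕ k))
                 (sym (lookup-swap-other x a d (λ { refl → <-irrefl refl a<c }) (λ { refl → <-irrefl refl xc<xd })))))

len-swap : ∀ {n} (x : Perm n) → IsPerm x → ∀ {a c} → a <ᶠ c → x ⟨ c ⟩ < x ⟨ a ⟩ →
           len x ≡ len (swap x a c) + suc (2 ℕ.* innerCount x a c)
len-swap x perm a<c xc<xa with g , xc+g≡xa ← ℕ.m≤n⇒∃[o]m+o≡n xc<xa =
  len-swap-gap g x perm a<c (trans (sym xc+g≡xa) (cong suc (ℕ.+-comm _ g)))

cover-descent : ∀ {n} {u v : Perm n} {a b} → IsPerm v → Cover u v a b → v ⟨ b ⟩ < v ⟨ a ⟩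
cover-descent {u = u} {v} {a} {b} perm cov with <-cmp (v ⟨ b ⟩) (v ⟨ a ⟩)
... | tri< vb<va _ _ = vb<va
... | tri≈ _ vb≡va _ = ⊥-elim (<-irrefl (cong toℕ (sym (injective-values v perm vb≡va))) (Cover.a<b cov))
... | tri> _ _ va<vb = ⊥-elim (ℕ.m≢1+m+n (len u) len-u)
  where
  u≡swap : u ≡ swap v a b
  u≡swap = cover-lower cov
  ub<ua : u ⟨ b ⟩ < u ⟨ a ⟩
  ub<ua rewrite u≡swap = subst₂ _<_ (sym (cong toℕ (lookup-swapʳ v a b))) (sym (cong toℕ (lookup-swapˡ v a b))) va<vb
  len-u : len u ≡ suc (len u) + suc (2 ℕ.* innerCount u a b)
  len-u = trans (len-swap u (cover-isPerm perm cov) (Cover.a<b cov) ub<ua)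
                (cong (_+ suc (2 ℕ.* innerCount u a b)) (trans (cong len (sym (Cover.v≡ut cov))) (Cover.lenUp cov)))

cover-innerCount≡0 : ∀ {n} {u v : Perm n} {a b} → IsPerm v → Cover u v a b → innerCount v a b ≡ 0
cover-innerCount≡0 {u = u} {v} {a} {b} perm cov =
  ℕ.m+n≡0⇒m≡0 (innerCount v a b) (suc-injective (ℕ.+-cancelˡ-≡ (len u) _ 1 (begin
    len u + suc (2 ℕ.* innerCount v a b)            ≡⟨ cong (λ t → len t + suc (2 ℕ.* innerCount v a b)) (cover-lower cov) ⟩
    len (swap v a b) + suc (2 ℕ.* innerCount v a b) ≡⟨ len-swap v perm (Cover.a<b cov) (cover-descent perm cov) ⟨
    len v                                           ≡⟨ Cover.lenUp cov ⟩
    suc (len u)                                     ≡⟨ ℕ.+-comm 1 (len u) ⟩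
    len u + 1                                       ∎)))
  where open ≡-Reasoning

cover-of-¬Inner : ∀ {n} (x : Perm n) → IsPerm x → ∀ {a c} → a <ᶠ c → x ⟨ c ⟩ < x ⟨ a ⟩ →
                  (∀ d → ¬ Inner x a c d) → Cover (swap x a c) x a c
cover-of-¬Inner x perm {a} {c} a<c xc<xa ¬inner = record
  { a<b   = a<c
  ; v≡ut  = sym (swap-involutive x a c)
  ; lenUp = trans (len-swap x perm a<c xc<xa)
                  (trans (cong (λ k → len (swap x a c) + suc (2 ℕ.* k)) (¬Inner⇒innerCount≡0 {x = x} ¬inner))
                         (ℕ.+-comm _ 1))
  }

Increasing : ∀ {n} → (Fin n → ℕ) → Set
Increasing f = ∀ {i j} → i <ᶠ j → f i < f j

increasing⇒toℕ≤ : ∀ {n} (f : Fin n → ℕ) → Increasing f → ∀ i → toℕ i ≤ f i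
increasing⇒toℕ≤ f increasing F.zero    = z≤n
increasing⇒toℕ≤ f increasing (F.suc i) =
  ≤-trans (s≤s (increasing⇒toℕ≤ (f ∘ inject₁) increasing-inject₁ i)) (increasing inject₁i<suci)
  where
  increasing-inject₁ : Increasing (f ∘ inject₁)
  increasing-inject₁ {j} {k} j<k = increasing (subst₂ _<_ (sym (toℕ-inject₁ j)) (sym (toℕ-inject₁ k)) j<k)
  inject₁i<suci : inject₁ i <ᶠ F.suc i
  inject₁i<suci = s≤s (ℕ.≤-reflexive (toℕ-inject₁ i))

increasing⇒+≤+toℕ : ∀ {n m} (f : Fin n → ℕ) → Increasing f → (∀ i → f i < m) → ∀ i → f i + n ≤ m + toℕ i
increasing⇒+≤+toℕ {suc n} {m} f increasing f<m (F.suc i) =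
  subst₂ _≤_ (sym (ℕ.+-suc _ n)) (sym (ℕ.+-suc m _))
    (s≤s (increasing⇒+≤+toℕ (f ∘ F.suc) (increasing ∘ s<s) (f<m ∘ F.suc) i))
increasing⇒+≤+toℕ {suc zero} {m} f increasing f<m F.zero =
  subst₂ _≤_ (ℕ.+-comm 1 _) (sym (ℕ.+-identityʳ m)) (f<m F.zero)
increasing⇒+≤+toℕ {suc (suc n)} {m} f increasing f<m F.zero = begin
  f F.zero + suc (suc n)      ≡⟨ ℕ.+-suc (f F.zero) (suc n) ⟩
  suc (f F.zero) + suc n      ≤⟨ ℕ.+-monoˡ-≤ (suc n) (increasing {F.zero} {F.suc F.zero} (s≤s z≤n)) ⟩
  f (F.suc F.zero) + suc n    ≤⟨ increasing⇒+≤+toℕ (f ∘ F.suc) (increasing ∘ s<s) (f<m ∘ F.suc) F.zero ⟩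
  m + 0                       ∎
  where open ℕ.≤-Reasoning

noInversions⇒idPerm : ∀ {n} (x : Perm n) → IsPerm x → (∀ i j → ¬ IsInv x (i , j)) → x ≡ idPerm
noInversions⇒idPerm {n} x perm noInv = perm-ext λ i →
  trans (toℕ-injective (ℕ.≤-antisym (x≤toℕ i) (increasing⇒toℕ≤ (x ⟨_⟩) increasing i)))
        (sym (lookup-allFin i))
  where
  increasing : Increasing (x ⟨_⟩)
  increasing {i} {j} i<j = ≤∧≢⇒< (ℕ.≮⇒≥ (λ xj<xi → noInv i j (i<j , xj<xi)))
                                   (λ xi≡xj → <-irrefl (cong toℕ (injective-values x perm xi≡xj)) i<j)
  x≤toℕ : ∀ i → x ⟨ i ⟩ ≤ toℕ i
  x≤toℕ i = ℕ.+-cancelʳ-≤ n _ _ (subst (x ⟨ i ⟩ + n ≤_) (ℕ.+-comm n (toℕ i))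
              (increasing⇒+≤+toℕ (x ⟨_⟩) increasing (toℕ<n ∘ lookup x) i))

idPerm⊎lowerCover : ∀ {n} (x : Perm n) → IsPerm x → x ≡ idPerm ⊎ ∃₂ λ a c → Cover (swap x a c) x a c
idPerm⊎lowerCover x perm with any? (λ i → any? (λ j → isInv? x (i , j)))
... | no ∄inv = inj₁ (noInversions⇒idPerm x perm (λ i j inv → ∄inv (i , j , inv)))
... | yes (a , b , a<b , xb<xa)
  with c , (a<c , xc<xa) , leftmost ←
         argmin-Fin (λ d → (a F.<? d) ×-dec (x ⟨ d ⟩ ℕ.<? x ⟨ a ⟩)) toℕ (a<b , xb<xa) =
  inj₂ (a , c , cover-of-¬Inner x perm a<c xc<xa
                  (λ d (a<d , d<c , _ , xd<xa) → ℕ.<⇒≱ d<c (leftmost (a<d , xd<xa))))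

idPerm≤B : ∀ {n} (x : Perm n) → IsPerm x → idPerm ≤B x
idPerm≤B x perm = descend (len x) x perm refl
  where
  descend : ∀ {n} m (y : Perm n) → IsPerm y → len y ≡ m → Chain idPerm y
  descend m y perm-y len≡m with idPerm⊎lowerCover y perm-y
  descend m       y perm-y len≡m   | inj₁ y≡id            = subst (Chain idPerm) (sym y≡id) []
  descend zero    y perm-y len≡0   | inj₂ (a , c , cover) = ⊥-elim (ℕ.1+n≢0 (trans (sym (Cover.lenUp cover)) len≡0))
  descend (suc m) y perm-y len≡1+m | inj₂ (a , c , cover) =
    descend m (swap y a c) (swap-isPerm y a c perm-y) (suc-injective (trans (sym (Cover.lenUp cover)) len≡1+m)) ▷ cover

GreedierCover : ∀ {n} → Perm n → Perm n → Fin n → Fin n → Set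
GreedierCover w′ v a b = (∃ λ b′ → b <ᶠ b′ × Cover w′ v a b′) ⊎ (∃ λ a′ → a′ <ᶠ a × Cover w′ v a′ b)

module _ {n} (v : Perm n) (perm : IsPerm v) {a b : Fin n} (a<b : a <ᶠ b) (¬inner : ∀ d → ¬ Inner v a b d) where

  lowerCover-right : ∀ {q} → b <ᶠ q → v ⟨ b ⟩ < v ⟨ q ⟩ → v ⟨ q ⟩ < v ⟨ a ⟩ →
                     ∃ λ c → b <ᶠ c × Cover (swap v a c) v a c
  lowerCover-right b<q vb<vq vq<va
    with c , (b<c , vb<vc , vc<va) , highest ←
         argmax-Fin (λ c → (b F.<? c) ×-dec ((v ⟨ b ⟩ ℕ.<? v ⟨ c ⟩) ×-dec (v ⟨ c ⟩ ℕ.<? v ⟨ a ⟩)))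
                    (v ⟨_⟩) (b<q , vb<vq , vq<va) =
    c , b<c , cover-of-¬Inner v perm (<-trans a<b b<c) vc<va ¬inner-ac
    where
    ¬inner-ac : ∀ d → ¬ Inner v a c d
    ¬inner-ac d (a<d , d<c , vc<vd , vd<va) with <-cmp (toℕ d) (toℕ b)
    ... | tri< d<b _ _ = ¬inner d (a<d , d<b , <-trans vb<vc vc<vd , vd<va)
    ... | tri≈ _ d≡b _ = <-asym vb<vc (subst (λ t → v ⟨ c ⟩ < v ⟨ t ⟩) (toℕ-injective d≡b) vc<vd)
    ... | tri> _ _ b<d = ℕ.<⇒≱ vc<vd (highest (b<d , <-trans vb<vc vc<vd , vd<va))

  lowerCover-left : ∀ {q} → q <ᶠ a → v ⟨ b ⟩ < v ⟨ q ⟩ → v ⟨ q ⟩ < v ⟨ a ⟩ →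
                    ∃ λ c → c <ᶠ a × Cover (swap v c b) v c b
  lowerCover-left q<a vb<vq vq<va
    with c , (c<a , vb<vc , vc<va) , lowest ←
         argmin-Fin (λ c → (c F.<? a) ×-dec ((v ⟨ b ⟩ ℕ.<? v ⟨ c ⟩) ×-dec (v ⟨ c ⟩ ℕ.<? v ⟨ a ⟩)))
                    (v ⟨_⟩) (q<a , vb<vq , vq<va) =
    c , c<a , cover-of-¬Inner v perm (<-trans c<a a<b) vb<vc ¬inner-cb
    where
    ¬inner-cb : ∀ d → ¬ Inner v c b d
    ¬inner-cb d (c<d , d<b , vb<vd , vd<vc) with <-cmp (toℕ d) (toℕ a)
    ... | tri< d<a _ _ = ℕ.<⇒≱ vd<vc (lowest (d<a , vb<vd , <-trans vd<vc vc<va))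
    ... | tri≈ _ d≡a _ = <-asym vc<va (subst (λ t → v ⟨ t ⟩ < v ⟨ c ⟩) (toℕ-injective d≡a) vd<vc)
    ... | tri> _ _ a<d = ¬inner d (a<d , d<b , vb<vd , <-trans vd<vc vc<va)

  lowerCover-between : ∀ {q} → v ⟨ b ⟩ < v ⟨ q ⟩ → v ⟨ q ⟩ < v ⟨ a ⟩ →
    ∃ λ w′ → GreedierCover w′ v a b
  lowerCover-between {q} vb<vq vq<va with <-cmp (toℕ q) (toℕ a)
  ... | tri< q<a _ _ = let c , c<a , cover = lowerCover-left q<a vb<vq vq<va in swap v c b , inj₂ (c , c<a , cover)
  ... | tri≈ _ q≡a _ = ⊥-elim (<-irrefl (cong (v ⟨_⟩) (toℕ-injective q≡a)) vq<va)
  ... | tri> _ _ a<q with <-cmp (toℕ q) (toℕ b)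
  ...   | tri< q<b _ _ = ⊥-elim (¬inner q (a<q , q<b , vb<vq , vq<va))
  ...   | tri≈ _ q≡b _ = ⊥-elim (<-irrefl (cong (v ⟨_⟩) (toℕ-injective (sym q≡b))) vb<vq)
  ...   | tri> _ _ b<q = let c , b<c , cover = lowerCover-right b<q vb<vq vq<va in swap v a c , inj₁ (c , b<c , cover)

  lowerCover-of-gap : suc (v ⟨ b ⟩) < v ⟨ a ⟩ →
    ∃ λ w′ → GreedierCover w′ v a b
  lowerCover-of-gap gap with q , vq≡1+vb ← values-surjective v perm (<-trans gap (toℕ<n (lookup v a))) =
    lowerCover-between (subst (v ⟨ b ⟩ <_) (sym vq≡1+vb) ≤-refl) (subst (_< v ⟨ a ⟩) (sym vq≡1+vb) gap)

greedy⇒adjacent : ∀ {n} {u v w : Perm n} {a b} → IsPerm v → Cover u v a b → v ≤B w →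
                  GreedyStep idPerm w v a b → v ⟨ a ⟩ ≡ suc (v ⟨ b ⟩)
greedy⇒adjacent {v = v} {w} {a} {b} perm cover v≤w greedy with v ⟨ a ⟩ ℕ.≟ suc (v ⟨ b ⟩)
... | yes adjacent = adjacent
... | no ¬adjacent
  with w′ , violation ← lowerCover-of-gap v perm (Cover.a<b cover)
                          (innerCount≡0⇒¬Inner {x = v} (cover-innerCount≡0 perm cover))
                          (≤∧≢⇒< (cover-descent perm cover) (¬adjacent ∘ sym)) =
  ⊥-elim (greedy (w′ , inInterval (cover-of violation) , violation))
  where
  inInterval : ∃₂ (Cover w′ v) → InInterval idPerm w w′
  inInterval (_ , _ , cover′) = idPerm≤B w′ (cover-isPerm perm cover′) , ([] ▷ cover′) ++ᶜ v≤w
  cover-of : GreedierCover w′ v a b → ∃₂ (Cover w′ v)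
  cover-of (inj₁ (_ , _ , cover′)) = _ , _ , cover′
  cover-of (inj₂ (_ , _ , cover′)) = _ , _ , cover′

GW-idPerm : ∀ {n} (x : Fin n → ℤ) → GW (idPerm {n}) x ≡ 1ℤ
GW-idPerm {n} x = cong (λ inv → foldr _*_ 1ℤ (map (λ p → edgeWt x (proj₁ p) (proj₂ p)) inv))
  (filter-none (isInv? idPerm) (All.universal ¬inversion (pairs n)))
  where
  ¬inversion : ∀ p → ¬ IsInv idPerm p
  ¬inversion (i , j) (i<j , j>i) = <-asym i<j (subst₂ _<ᶠ_ (lookup-allFin j) (lookup-allFin i) j>i)

GW-swap-adjacent : ∀ {n} (v : Perm n) → IsPerm v → ∀ {a b} → a <ᶠ b → v ⟨ a ⟩ ≡ suc (v ⟨ b ⟩) →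
                   (x : Fin n → ℤ) → GW v x ≡ GW (swap v a b) x * edgeWt x a b
GW-swap-adjacent {n} v perm a<b adjacent x with xs , ys , Inv-v , Inv-swap ← Inv-swap-adjacent v perm a<b adjacent =
  trans (cong product Inv-v) (trans (product-insert weight xs) (cong (λ inv → product inv * _) (sym Inv-swap)))
  where
  weight : Fin n × Fin n → ℤ
  weight p = edgeWt x (proj₁ p) (proj₂ p)
  product : List (Fin n × Fin n) → ℤ
  product inv = foldr _*_ 1ℤ (map weight inv)

greedy-weight : ∀ {n} {v w : Perm n} (C : Chain idPerm v) → AllGreedy idPerm w C → v ≤B w →
                (x : Fin n → ℤ) → chainWt x C ≡ GW v x
greedy-weight [] _ _ x = sym (GW-idPerm x)
greedy-weight {v = v} (_▷_ {v = u} {a = a} {b} C cover) (greedy-C , greedy) v≤w x = begin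
  chainWt x C * edgeWt x a b         ≡⟨ cong (_* edgeWt x a b) (greedy-weight C greedy-C (([] ▷ cover) ++ᶜ v≤w) x) ⟩
  GW u x * edgeWt x a b              ≡⟨ cong (λ t → GW t x * edgeWt x a b) (cover-lower cover) ⟩
  GW (swap v a b) x * edgeWt x a b   ≡⟨ GW-swap-adjacent v perm (Cover.a<b cover) adjacent x ⟨
  GW v x                             ∎
  where
  open ≡-Reasoning
  perm : IsPerm v
  perm = chain-isPerm (C ▷ cover)
  adjacent : v ⟨ a ⟩ ≡ suc (v ⟨ b ⟩)
  adjacent = greedy⇒adjacent perm cover v≤w greedy

lemma3p10 : (n : ℕ) (w : Perm n) → IsPerm w →
    (C : Chain idPerm w) → Greedy C →
    (x : Fin n → ℤ) → chainWt x C ≡ GW w x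
lemma3p10 n w _ C greedy x = greedy-weight C greedy [] x
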